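{- Let $G=(V,E)$ be an undirected graph, $k\ge 3$ an integer, $\gamma$ a positive integer, and $G_T$ the transformed graph described in the context. Then the hop distance in $G_T$ between any two nodes of $V_{\text{edges}}$ is a multiple of $2(k-2)$, and the hop distance between $w_{e}$ and $w_{f}$ is at least $4k-8$ whenever the original edges $e,f\in E$ are not adjacent in $G$ (share no endpoint).
   Context: Hop distance $\hat d(u,v)$ in an unweighted graph is the minimum number of edges of a shortest path between $u$ and $v$. Construction of $G_T$ (unit weights): replace each edge $\{u,v\}\in E$ by a fresh path $u,s_{k-3},\dots,s_1,w_{u,v},s'_1,\dots,s'_{k-3},v$ (for $k=3$: $u,w_{u,v},v$); $V_{\text{edges}}=\{w_{u,v}:\{u,v\}\in E\}$, where $w_e$ denotes the vertex $w_{u,v}$ for $e=\{u,v\}$. For each $v\in V$ attach a fresh $\gamma$-pitchfork: a star with center (base) $b_v$ and $\gamma+1$ satellites, exactly one of which is also adjacent to $v$. -}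

module Defs where

open import Data.Nat using (ℕ; zero; suc; _+_; _*_; _∸_; _≤_)
open import Data.Fin using (Fin; toℕ)
import Data.Fin as Fin
open import Data.Product using (_×_; _,_)
open import Data.Sum using (_⊎_)
open import Relation.Binary.PropositionalEquality using (_≡_; _≢_)

-- Each edge e is stored with its two endpoints src e, tgt e (an arbitrary
-- orientation; the graph itself is undirected).
record Graph : Set where
  field
    n m      : ℕ
    src tgt  : Fin m → Fin n
    loopless : ∀ e → src e ≢ tgt e
    simple   : ∀ e f →
               ((src e ≡ src f × tgt e ≡ tgt f) ⊎ (src e ≡ tgt f × tgt e ≡ src f)) →
               e ≡ f

open Graph public

ShareEndpoint : (G : Graph) → Fin (m G) → Fin (m G) → Set
ShareEndpoint G e f =
  (src G e ≡ src G f) ⊎ (src G e ≡ tgt G f) ⊎ (tgt G e ≡ src G f) ⊎ (tgt G e ≡ tgt G f)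

-- For edge e = {u,v} with u = src e, v = tgt e, the path is
--   u, s_{k-3}, ..., s_1, w_e, s'_1, ..., s'_{k-3}, v
-- and  s e i  stands for s_{i+1},  s' e i  for s'_{i+1}  (i : Fin (k-3)).
-- base v is b_v, and sat v j (j : Fin (γ+1)) are the γ+1 satellites;
-- sat v zero is the satellite that is also adjacent to v.
data VT (G : Graph) (k γ : ℕ) : Set where
  orig : Fin (n G) → VT G k γ
  s    : Fin (m G) → Fin (k ∸ 3) → VT G k γ
  s'   : Fin (m G) → Fin (k ∸ 3) → VT G k γ
  w    : Fin (m G) → VT G k γ
  base : Fin (n G) → VT G k γ
  sat  : Fin (n G) → Fin (suc γ) → VT G k γ

data Arc (G : Graph) (k γ : ℕ) : VT G k γ → VT G k γ → Set where
  u-w    : ∀ e → k ≡ 3 → Arc G k γ (orig (src G e)) (w e)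
  w-v    : ∀ e → k ≡ 3 → Arc G k γ (w e) (orig (tgt G e))
  u-s    : ∀ e i → toℕ i ≡ k ∸ 4 → Arc G k γ (orig (src G e)) (s e i)
  s-s    : ∀ e i j → toℕ i ≡ suc (toℕ j) → Arc G k γ (s e i) (s e j)
  s-w    : ∀ e i → toℕ i ≡ 0 → Arc G k γ (s e i) (w e)
  w-s'   : ∀ e i → toℕ i ≡ 0 → Arc G k γ (w e) (s' e i)
  s'-s'  : ∀ e i j → toℕ j ≡ suc (toℕ i) → Arc G k γ (s' e i) (s' e j)
  s'-v   : ∀ e i → toℕ i ≡ k ∸ 4 → Arc G k γ (s' e i) (orig (tgt G e))
  star   : ∀ v j → Arc G k γ (base v) (sat v j)
  handle : ∀ v → Arc G k γ (sat v Fin.zero) (orig v)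

Adj : (G : Graph) (k γ : ℕ) → VT G k γ → VT G k γ → Set
Adj G k γ x y = Arc G k γ x y ⊎ Arc G k γ y x

data Walk (G : Graph) (k γ : ℕ) : VT G k γ → VT G k γ → ℕ → Set where
  here : ∀ {x} → Walk G k γ x x 0
  step : ∀ {x y z d} → Adj G k γ x y → Walk G k γ y z d → Walk G k γ x z (suc d)

HopDist : (G : Graph) (k γ : ℕ) → VT G k γ → VT G k γ → ℕ → Set
HopDist G k γ x y d = Walk G k γ x y d × (∀ d' → Walk G k γ x y d' → d ≤ d')

{-# OPTIONS --safe #-}
-- Write L = k - 2. Forgetting the pitchforks, G_T is G with every edge e
-- subdivided into a path of length 2L whose midpoint is w_e. A walk from
-- w_e to w_f must leave e's path through an endpoint (L steps), cross some
-- number t of whole edge paths, and enter f's path through an endpoint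
-- (L steps), so its length is at least (t + 1) 2L; a shortest walk attains
-- this, and t = 0 happens only if e and f share an endpoint. The lower bound
-- is proved by induction on the walk, backwards from w_f, keeping track of
-- the position of the current vertex on its edge path.
module Submission where

open import Defs
open import Data.Nat using (ℕ; zero; suc; _+_; _*_; _∸_; _≤_; _<_; z≤n; s≤s)
open import Data.Nat.Properties
open import Data.Nat.Divisibility using (_∣_; divides)
open import Data.Nat.Tactic.RingSolver using (solve-∀)
open import Data.Fin using (Fin; toℕ; fromℕ<)
open import Data.Fin.Properties using (toℕ-fromℕ<; toℕ<n)
open import Data.Product using (Σ-syntax; _×_; _,_)
open import Data.Sum using (_⊎_; inj₁; inj₂)
open import Data.Empty using (⊥-elim)
open import Relation.Nullary using (¬_)
open import Relation.Binary.PropositionalEquality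

m∸n≡1+[m∸o] : ∀ m {n o} → o ≡ suc n → o < m → m ∸ n ≡ suc (m ∸ o)
m∸n≡1+[m∸o] (suc m) {zero}  refl _         = refl
m∸n≡1+[m∸o] (suc m) {suc n} refl (s≤s o<m) = m∸n≡1+[m∸o] m refl o<m

last-index : ∀ {r} (i : Fin r) → toℕ i ≡ r ∸ 1 → r ≡ suc (toℕ i)
last-index {suc r} i i≡r = cong suc (sym i≡r)

route-length : ∀ L t → L + (t * (L + L) + L) ≡ suc t * (2 * L)
route-length = solve-∀

4[3+r]∸8≡2*[2*[1+r]] : ∀ r → 4 * (3 + r) ∸ 8 ≡ 2 * (2 * suc r)
4[3+r]∸8≡2*[2*[1+r]] r = trans (cong (_∸ 8) (expand r)) (m+n∸m≡n 8 (2 * (2 * suc r)))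
  where
    expand : ∀ r → 4 * (3 + r) ≡ 8 + 2 * (2 * suc r)
    expand = solve-∀

IsEndpoint : (G : Graph) → Fin (m G) → Fin (n G) → Set
IsEndpoint G e a = a ≡ src G e ⊎ a ≡ tgt G e

common-endpoint : ∀ G {e f a} → IsEndpoint G e a → IsEndpoint G f a → ShareEndpoint G e f
common-endpoint _ (inj₁ refl) (inj₁ eq) = inj₁ eq
common-endpoint _ (inj₁ refl) (inj₂ eq) = inj₂ (inj₁ eq)
common-endpoint _ (inj₂ refl) (inj₁ eq) = inj₂ (inj₂ (inj₁ eq))
common-endpoint _ (inj₂ refl) (inj₂ eq) = inj₂ (inj₂ (inj₂ eq))

module _ {G : Graph} {k γ : ℕ} where

  Adj-sym : ∀ {x y} → Adj G k γ x y → Adj G k γ y x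
  Adj-sym (inj₁ a) = inj₂ a
  Adj-sym (inj₂ a) = inj₁ a

  infixr 5 _++_
  _++_ : ∀ {x y z a b} → Walk G k γ x y a → Walk G k γ y z b → Walk G k γ x z (a + b)
  here       ++ q = q
  step a p   ++ q = step a (p ++ q)

  reverse : ∀ {x y d} → Walk G k γ x y d → Walk G k γ y x d
  reverse here               = here
  reverse (step {d = d} a p) = subst (Walk G k γ _ _) (+-comm d 1) (reverse p ++ step (Adj-sym a) here)

  orig-walk₀⇒≡ : ∀ {a b} → Walk G k γ (orig a) (orig b) 0 → a ≡ b
  orig-walk₀⇒≡ here = refl

  ladder : ∀ {r} (x : Fin r → VT G k γ) {t} →
           (∀ i j → toℕ i ≡ suc (toℕ j) → Adj G k γ (x i) (x j)) →
           (∀ i → toℕ i ≡ 0 → Adj G k γ (x i) t) →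
           ∀ n (n<r : n < r) → Walk G k γ (x (fromℕ< n<r)) t (suc n)
  ladder x down bottom zero    n<r = step (bottom _ (toℕ-fromℕ< n<r)) here
  ladder x down bottom (suc n) n<r =
    step (down _ _ (trans (toℕ-fromℕ< n<r) (cong suc (sym (toℕ-fromℕ< (<⇒≤ n<r))))))
         (ladder x down bottom n (<⇒≤ n<r))

module _ (G : Graph) (γ : ℕ) where

  src⇝w : ∀ r e → Walk G (3 + r) γ (orig (src G e)) (w e) (suc r)
  src⇝w zero    e = step (inj₁ (u-w e refl)) here
  src⇝w (suc r) e =
    step (inj₁ (u-s e _ (toℕ-fromℕ< ≤-refl)))
         (ladder (s e) (λ i j i≡1+j → inj₁ (s-s e i j i≡1+j)) (λ i i≡0 → inj₁ (s-w e i i≡0)) r ≤-refl)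

  w⇝tgt : ∀ r e → Walk G (3 + r) γ (w e) (orig (tgt G e)) (suc r)
  w⇝tgt zero    e = step (inj₁ (w-v e refl)) here
  w⇝tgt (suc r) e = reverse
    (step (inj₂ (s'-v e _ (toℕ-fromℕ< ≤-refl)))
          (ladder (s' e) (λ i j i≡1+j → inj₂ (s'-s' e j i i≡1+j)) (λ i i≡0 → inj₂ (w-s' e i i≡0)) r ≤-refl))

  module _ (r : ℕ) where

    private
      L : ℕ
      L = suc r

    endpoint⇝w : ∀ {f b} → IsEndpoint G f b → Walk G (3 + r) γ (orig b) (w f) L
    endpoint⇝w {f} (inj₁ refl) = src⇝w r f
    endpoint⇝w {f} (inj₂ refl) = reverse (w⇝tgt r f)

    -- mid e p q is the point of e's subdivided path at distance p from src e
    -- and q from tgt e; the pitchfork of v is collapsed onto node v.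
    data Loc : Set where
      node : Fin (n G) → Loc
      mid  : Fin (m G) → ℕ → ℕ → Loc

    loc : VT G (3 + r) γ → Loc
    loc (orig v)  = node v
    loc (base v)  = node v
    loc (sat v _) = node v
    loc (w e)     = mid e L L
    loc (s e i)   = mid e (r ∸ toℕ i) (suc (toℕ i) + L)
    loc (s' e i)  = mid e (suc (toℕ i) + L) (r ∸ toℕ i)

    data Step : Loc → Loc → Set where
      stay   : ∀ {x} → Step x x
      leave  : ∀ e {p q} → p ≡ 1 → suc q ≡ L + L → Step (node (src G e)) (mid e p q)
      along  : ∀ e {p q p′ q′} → p′ ≡ suc p → q ≡ suc q′ → Step (mid e p q) (mid e p′ q′)
      arrive : ∀ e {p q} → q ≡ 1 → suc p ≡ L + L → Step (mid e p q) (node (tgt G e))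

    outermost : (i : Fin r) → toℕ i ≡ r ∸ 1 → r ∸ toℕ i ≡ 1 × suc (suc (toℕ i) + L) ≡ L + L
    outermost i i≡r-1 =
      trans (cong (_∸ toℕ i) r≡1+i) (m+n∸n≡m 1 (toℕ i)) , cong (λ n → suc n + L) (sym r≡1+i)
      where r≡1+i = last-index i i≡r-1

    Arc⇒Step : ∀ {x y} → Arc G (3 + r) γ x y → Step (loc x) (loc y)
    Arc⇒Step (u-w e refl)        = leave e refl refl
    Arc⇒Step (w-v e refl)        = arrive e refl refl
    Arc⇒Step (u-s e i i≡r-1)     = let (p≡1 , q≡) = outermost i i≡r-1 in leave e p≡1 q≡
    Arc⇒Step (s-s e i j i≡1+j)   =
      along e (m∸n≡1+[m∸o] r i≡1+j (toℕ<n i)) (cong (λ n → suc n + L) i≡1+j)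
    Arc⇒Step (s-w e i i≡0)       =
      along e (cong (λ n → suc (r ∸ n)) (sym i≡0)) (cong (λ n → suc n + L) i≡0)
    Arc⇒Step (w-s' e i i≡0)      =
      along e (cong (λ n → suc n + L) i≡0) (cong (λ n → suc (r ∸ n)) (sym i≡0))
    Arc⇒Step (s'-s' e i j j≡1+i) =
      along e (cong (λ n → suc n + L) j≡1+i) (m∸n≡1+[m∸o] r j≡1+i (toℕ<n j))
    Arc⇒Step (s'-v e i i≡r-1)    = let (q≡1 , p≡) = outermost i i≡r-1 in arrive e q≡1 p≡
    Arc⇒Step (star v j)          = stay
    Arc⇒Step (handle v)          = stay

    data Anchor : Loc → Fin (n G) → ℕ → Set where
      at-node : ∀ {v} → Anchor (node v) v 0
      at-src  : ∀ {e p q} → Anchor (mid e p q) (src G e) p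
      at-tgt  : ∀ {e p q} → Anchor (mid e p q) (tgt G e) q

    -- Route f a c d: d is at least the length c + 2Lt + L of a walk that goes
    -- from a point at distance c from node a to a, through t whole edge paths
    -- to an endpoint b of f, and along the half path from b to w_f.
    data Route (f : Fin (m G)) (a : Fin (n G)) (c d : ℕ) : Set where
      route : ∀ {b} t → Walk G (3 + r) γ (orig a) (orig b) (t * (L + L)) → IsEndpoint G f b →
              c + (t * (L + L) + L) ≤ d → Route f a c d

    Route-mono : ∀ {f a c c′ d} → c′ ≤ suc c → Route f a c d → Route f a c′ (suc d)
    Route-mono c′≤ (route t walk fb c≤) =
      route t walk fb (≤-trans (+-monoˡ-≤ (t * (L + L) + L) c′≤) (s≤s c≤))

    Route-cross : ∀ {f a′ a c d} → Walk G (3 + r) γ (orig a′) (orig a) (L + L) → L + L ≡ suc c →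
                  Route f a c d → Route f a′ 0 (suc d)
    Route-cross edge refl (route t walk fb c≤) =
      route (suc t) (edge ++ walk) fb (≤-trans (≤-reflexive (+-assoc (L + L) (t * (L + L)) L)) (s≤s c≤))

    -- Bound f x d is what a walk of length d from x to w_f certifies: x lies on
    -- f's own path within distance d of w_f (near), or d bounds a route from
    -- an anchor of x (far).
    data Bound (f : Fin (m G)) : Loc → ℕ → Set where
      near : ∀ {p q d} → L ≤ p + d → L ≤ q + d → Bound f (mid f p q) d
      far  : ∀ {x a c d} → Anchor x a c → Route f a c d → Bound f x d

    Bound-suc : ∀ {f x d} → Bound f x d → Bound f x (suc d)
    Bound-suc {d = d} (near {p} {q} p≤ q≤) =
      near (≤-trans p≤ (+-monoʳ-≤ p (n≤1+n d))) (≤-trans q≤ (+-monoʳ-≤ q (n≤1+n d)))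
    Bound-suc (far {c = c} anchor ρ) = far anchor (Route-mono (n≤1+n c) ρ)

    edge⇝ : ∀ e → Walk G (3 + r) γ (orig (src G e)) (orig (tgt G e)) (L + L)
    edge⇝ e = src⇝w r e ++ w⇝tgt r e

    Bound-cons⁺ : ∀ {f x y d} → Step x y → Bound f y d → Bound f x (suc d)
    Bound-cons⁺ stay                 bound             = Bound-suc bound
    Bound-cons⁺ (leave e refl _)     (near p≤ _)       = far at-node (route 0 here (inj₁ refl) p≤)
    Bound-cons⁺ (leave e refl _)     (far at-src ρ)    = far at-node (Route-mono z≤n ρ)
    Bound-cons⁺ (leave e refl 1+q≡)  (far at-tgt ρ)    = far at-node (Route-cross (edge⇝ e) (sym 1+q≡) ρ)
    Bound-cons⁺ {d = d} (along e {p} {q′ = q′} refl refl) (near p≤ q≤) =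
      near (≤-trans p≤ (≤-reflexive (sym (+-suc p d)))) (≤-trans q≤ (+-mono-≤ (n≤1+n q′) (n≤1+n d)))
    Bound-cons⁺ (along e {p} refl refl) (far at-src ρ) = far at-src (Route-mono (m≤n⇒m≤1+n (n≤1+n p)) ρ)
    Bound-cons⁺ (along e refl refl)  (far at-tgt ρ)    = far at-tgt (Route-mono ≤-refl ρ)
    Bound-cons⁺ (arrive e refl _)    (far at-node ρ)   = far at-tgt (Route-mono ≤-refl ρ)

    Bound-cons⁻ : ∀ {f x y d} → Step y x → Bound f y d → Bound f x (suc d)
    Bound-cons⁻ stay                 bound             = Bound-suc bound
    Bound-cons⁻ (leave e refl _)     (far at-node ρ)   = far at-src (Route-mono ≤-refl ρ)
    Bound-cons⁻ {d = d} (along e {p} {q′ = q′} refl refl) (near p≤ q≤) =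
      near (≤-trans p≤ (+-mono-≤ (n≤1+n p) (n≤1+n d))) (≤-trans q≤ (≤-reflexive (sym (+-suc q′ d))))
    Bound-cons⁻ (along e refl refl)  (far at-src ρ)    = far at-src (Route-mono ≤-refl ρ)
    Bound-cons⁻ (along e {q′ = q′} refl refl) (far at-tgt ρ) = far at-tgt (Route-mono (m≤n⇒m≤1+n (n≤1+n q′)) ρ)
    Bound-cons⁻ (arrive e refl _)    (near _ q≤)       = far at-node (route 0 here (inj₂ refl) q≤)
    Bound-cons⁻ (arrive e refl 1+p≡) (far at-src ρ)    = far at-node (Route-cross (reverse (edge⇝ e)) (sym 1+p≡) ρ)
    Bound-cons⁻ (arrive e refl _)    (far at-tgt ρ)    = far at-node (Route-mono z≤n ρ)

    Walk⇒Bound : ∀ {f x d} → Walk G (3 + r) γ x (w f) d → Bound f (loc x) d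
    Walk⇒Bound here               = near (m≤m+n L 0) (m≤m+n L 0)
    Walk⇒Bound (step (inj₁ a) wk) = Bound-cons⁺ (Arc⇒Step a) (Walk⇒Bound wk)
    Walk⇒Bound (step (inj₂ a) wk) = Bound-cons⁻ (Arc⇒Step a) (Walk⇒Bound wk)

    HopDistShape : Fin (m G) → Fin (m G) → ℕ → Set
    HopDistShape e f d = Σ[ t ∈ ℕ ] d ≡ t * (2 * L) × (¬ ShareEndpoint G e f → 2 ≤ t)

    Route⇒HopDistShape : ∀ {e f a d} → IsEndpoint G e a → Route f a L d →
                         (∀ d′ → Walk G (3 + r) γ (w e) (w f) d′ → d ≤ d′) → HopDistShape e f d
    Route⇒HopDistShape {e} {f} {a} ea (route {b} t walk fb d≥) minimal =
      suc t , trans d≡ (route-length L t) , 2≤1+t t walk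
      where
        d≡ = ≤-antisym (minimal _ (reverse (endpoint⇝w ea) ++ walk ++ endpoint⇝w fb)) d≥

        2≤1+t : ∀ t → Walk G (3 + r) γ (orig a) (orig b) (t * (L + L)) → ¬ ShareEndpoint G e f → 2 ≤ suc t
        2≤1+t zero    walk₀ unshared =
          ⊥-elim (unshared (common-endpoint G ea (subst (IsEndpoint G f) (sym (orig-walk₀⇒≡ walk₀)) fb)))
        2≤1+t (suc t) _     _        = s≤s (s≤s z≤n)

    hopDist-w : ∀ {e f d} → HopDist G (3 + r) γ (w e) (w f) d → HopDistShape e f d
    hopDist-w (walk , minimal) with Walk⇒Bound walk
    -- near unifies f with e.
    ... | near _ _       = 0 , n≤0⇒n≡0 (minimal 0 here) , λ unshared → ⊥-elim (unshared (inj₁ refl))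
    ... | far at-src ρ   = Route⇒HopDistShape (inj₁ refl) ρ minimal
    ... | far at-tgt ρ   = Route⇒HopDistShape (inj₂ refl) ρ minimal

lemma18 : (G : Graph) (k γ : ℕ) → 3 ≤ k → 1 ≤ γ →
            (e f : Fin (m G)) →
            (∀ d → HopDist G k γ (w e) (w f) d → (2 * (k ∸ 2)) ∣ d) ×
            (¬ ShareEndpoint G e f → ∀ d → HopDist G k γ (w e) (w f) d → 4 * k ∸ 8 ≤ d)
lemma18 G (suc (suc (suc r))) γ _ _ e f = divisible , separated
  where
    divisible : ∀ d → HopDist G (3 + r) γ (w e) (w f) d → 2 * suc r ∣ d
    divisible d dist with hopDist-w G γ r dist
    ... | t , d≡ , _ = divides t d≡

    separated : ¬ ShareEndpoint G e f → ∀ d → HopDist G (3 + r) γ (w e) (w f) d → 4 * (3 + r) ∸ 8 ≤ d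
    separated unshared d dist with hopDist-w G γ r dist
    ... | t , d≡ , 2≤t = begin
      4 * (3 + r) ∸ 8  ≡⟨ 4[3+r]∸8≡2*[2*[1+r]] r ⟩
      2 * (2 * suc r)  ≤⟨ *-monoˡ-≤ (2 * suc r) (2≤t unshared) ⟩
      t * (2 * suc r)  ≡⟨ sym d≡ ⟩
      d                ∎
      where open ≤-Reasoning
lemma18 G (suc zero)       γ (s≤s ())       _ _ _
lemma18 G (suc (suc zero)) γ (s≤s (s≤s ())) _ _ _
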